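{- Let $\mathbb F$ be a field, $d$ even, $n\ge1$, and let $A_1,\dots,A_d$ be $n\times n$ matrices over $\mathbb F$. Define $T\in\mathsf T^d(n)$ by $T(i_1,\dots,i_d)=\sum_{\ell=1}^nA_1(i_1,\ell)\cdots A_d(i_d,\ell)$. Then $\det(T)=\det(A_1)\cdots\det(A_d)$.
   Context: $\mathsf T^d(n)$ is the set of functions $T:[n]^d\to\mathbb F$. The hyperdeterminant is $\det(T)=\sum_{\sigma_2,\dots,\sigma_d\in S_n}\mathrm{sgn}(\sigma_2\cdots\sigma_d)\prod_{i=1}^nT(i,\sigma_2(i),\dots,\sigma_d(i))$; for matrices $\det$ is the usual determinant. -}

module Defs where

open import Level using (_⊔_)
open import Algebra.Bundles using (CommutativeRing)
open import Data.Nat using (ℕ; zero; suc)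
open import Data.Bool using (Bool; true; false; _∧_; _∨_; not; if_then_else_)
open import Data.Fin using (Fin; _<?_)
open import Data.Fin.Properties using (_≟_)
open import Data.List using (List; []; _∷_; map; concatMap; foldr; filterᵇ; length; allFin)
open import Data.Bool.ListAction using (and)
open import Data.Vec.Functional using () renaming (_∷_ to _◂_)
open import Data.Product using (Σ-syntax)
open import Relation.Nullary using (¬_)
open import Relation.Nullary.Decidable using (⌊_⌋)
open import Function using (_∘_; id)

record IsField {c ℓ} (R : CommutativeRing c ℓ) : Set (c ⊔ ℓ) where
  open CommutativeRing R
  field
    0≉1     : ¬ (0# ≈ 1#)
    inverse : ∀ x → ¬ (x ≈ 0#) → Σ[ y ∈ Carrier ] (x * y ≈ 1#)

allFuns : (n m : ℕ) → List (Fin n → Fin m)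
allFuns zero    m = (λ ()) ∷ []
allFuns (suc n) m = concatMap (λ f → map (λ j → j ◂ f) (allFin m)) (allFuns n m)

isPermᵇ : ∀ {n} → (Fin n → Fin n) → Bool
isPermᵇ {n} σ = and (concatMap (λ i → map (λ j → not ⌊ σ i ≟ σ j ⌋ ∨ ⌊ i ≟ j ⌋) (allFin n)) (allFin n))

Perms : (n : ℕ) → List (Fin n → Fin n)
Perms n = filterᵇ isPermᵇ (allFuns n n)

inversions : ∀ {n} → (Fin n → Fin n) → ℕ
inversions {n} σ = length (filterᵇ id
  (concatMap (λ i → map (λ j → ⌊ i <? j ⌋ ∧ ⌊ σ j <? σ i ⌋) (allFin n)) (allFin n)))

evenᵇ : ℕ → Bool
evenᵇ zero          = true
evenᵇ (suc zero)    = false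
evenᵇ (suc (suc k)) = evenᵇ k

PermTuples : (k n : ℕ) → List (Fin k → (Fin n → Fin n))
PermTuples zero    n = (λ ()) ∷ []
PermTuples (suc k) n = concatMap (λ τ → map (λ σ → σ ◂ τ) (Perms n)) (PermTuples k n)

compose : ∀ {k n} → (Fin k → (Fin n → Fin n)) → (Fin n → Fin n)
compose {k} τ = foldr (λ t f → τ t ∘ f) id (allFin k)

module Over {c ℓ} (R : CommutativeRing c ℓ) where
  open CommutativeRing R

  sgn : ∀ {n} → (Fin n → Fin n) → Carrier
  sgn σ = if evenᵇ (inversions σ) then 1# else - 1#

  Σ-list : ∀ {a} {A : Set a} → List A → (A → Carrier) → Carrier
  Σ-list xs f = foldr (λ x acc → f x + acc) 0# xs

  Π-list : ∀ {a} {A : Set a} → List A → (A → Carrier) → Carrier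
  Π-list xs f = foldr (λ x acc → f x * acc) 1# xs

  Σ[<_]_ : (n : ℕ) → (Fin n → Carrier) → Carrier
  Σ[< n ] f = Σ-list (allFin n) f

  Π[<_]_ : (n : ℕ) → (Fin n → Carrier) → Carrier
  Π[< n ] f = Π-list (allFin n) f

  Matrix : ℕ → Set c
  Matrix n = Fin n → Fin n → Carrier

  det : ∀ {n} → Matrix n → Carrier
  det {n} A = Σ-list (Perms n) (λ σ → sgn σ * (Π[< n ] λ i → A i (σ i)))

  Tensor : ℕ → ℕ → Set c
  Tensor d n = (Fin d → Fin n) → Carrier

  hdet : ∀ {k n} → Tensor (suc k) n → Carrier
  hdet {k} {n} T = Σ-list (PermTuples k n) (λ τ →
    sgn (compose τ) * (Π[< n ] λ i → T (i ◂ (λ t → τ t i))))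

-- Expanding every entry T(i , σ₂ i , … , σ_d i) = Σ_l Π_t A_t(·, l) and the product over i writes det T
-- as a sum over all maps f : [n] → [n] of Π_i A₁(i , f i) · Π_{t ≥ 2} det (A_tᵀ ∘ f), where A_tᵀ ∘ f is
-- the matrix whose i-th row is the f(i)-th column of A_t.  Such a determinant vanishes unless f is a
-- permutation (two rows coincide) and is sgn f · det A_t otherwise.  As d - 1 is odd, the d - 1 signs
-- multiply to sgn f, and the remaining sum over permutations f is det A₁.
--
-- Functions on Fin n are only equal pointwise, so sums over permutations are reindexed by comparing
-- multiplicities with respect to ≗ rather than by rearranging lists.
module Submission where

open import Defs
open import Level using (0ℓ)
open import Algebra.Bundles using (CommutativeMonoid; CommutativeRing)
open import Data.Bool using (Bool; true; false; not; _∧_; _∨_; if_then_else_)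
open import Data.Bool.ListAction using (and)
open import Data.Bool.Properties using (T-≡; ∧-comm; ∧-identityʳ; ∧-zeroʳ)
open import Data.Empty using (⊥-elim)
open import Data.Fin using (Fin; zero; suc; punchOut; _<_; _<?_)
open import Data.Fin.Properties
  using (_≟_; ≡-decSetoid; any?; punchOut-injective; injective⇒≤; <-cmp; <-irrefl; <-asym; <-trans)
open import Data.Fin.Permutation.Components using (transpose; transpose-inverse)
open import Data.List using (List; []; _∷_; _++_; map; concat; concatMap; foldr; filterᵇ; length; tabulate; allFin)
import Data.List.Properties as List
open import Data.List.Membership.Propositional using (_∈_)
open import Data.List.Membership.Propositional.Properties
  using (∈-allFin; ∈-map⁺; ∈-map⁻; ∈-concatMap⁺; ∈-concatMap⁻)
open import Data.List.Relation.Unary.All as All using (All)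
open import Data.List.Relation.Unary.All.Properties using (all-filter; concat⁺; map⁺)
open import Data.List.Relation.Unary.Any as Any using (Any; here; there; lookup; _─_)
open import Data.List.Relation.Unary.Any.Properties using (lookup-result)
open import Data.Nat using (ℕ; zero; suc; _≤_)
import Data.Nat as ℕ
import Data.Nat.Properties as ℕ
open import Data.Nat.Divisibility using (_∣_; divides)
open import Data.Product using (∃; ∃₂; _×_; _,_; uncurry)
open import Data.Vec.Functional using () renaming (_∷_ to _◂_)
open import Function using (_∘_; id)
open import Function.Bundles using (_⇔_; mk⇔; Equivalence)
open import Function.Definitions using (Congruent; Injective; Inverseᵇ)
import Function.Consequences.Propositional as Consequences
open import Relation.Binary.Bundles using (DecSetoid)
open import Relation.Binary.Definitions using (Decidable; tri<; tri≈; tri>)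
open import Relation.Binary.PropositionalEquality as ≡ using (_≡_; _≢_; _≗_)
open import Relation.Nullary using (¬_; yes; no; does)
open import Relation.Nullary.Decidable using (⌊_⌋; T?; map′; _×-dec_)

module Big {c ℓ} (M : CommutativeMonoid c ℓ) where
  open CommutativeMonoid M
  open import Algebra.Properties.CommutativeSemigroup commutativeSemigroup using (interchange; x∙yz≈y∙xz)

  big : ∀ {a} {X : Set a} → List X → (X → Carrier) → Carrier
  big xs f = foldr (λ x acc → f x ∙ acc) ε xs

  module _ {a} {X : Set a} where

    big-cong : ∀ xs {f g : X → Carrier} → (∀ x → f x ≈ g x) → big xs f ≈ big xs g
    big-cong []       f≈g = refl
    big-cong (x ∷ xs) f≈g = ∙-cong (f≈g x) (big-cong xs f≈g)

    big-cong-All : ∀ {p} {P : X → Set p} {xs} → All P xs → {f g : X → Carrier} →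
                   (∀ x → P x → f x ≈ g x) → big xs f ≈ big xs g
    big-cong-All All.[]         f≈g = refl
    big-cong-All (px All.∷ pxs) f≈g = ∙-cong (f≈g _ px) (big-cong-All pxs f≈g)

    big-ε : (xs : List X) → big xs (λ _ → ε) ≈ ε
    big-ε []       = refl
    big-ε (x ∷ xs) = trans (identityˡ (big xs (λ _ → ε))) (big-ε xs)

    big-++ : ∀ xs ys (f : X → Carrier) → big (xs ++ ys) f ≈ big xs f ∙ big ys f
    big-++ []       ys f = sym (identityˡ _)
    big-++ (x ∷ xs) ys f = trans (∙-congˡ (big-++ xs ys f)) (sym (assoc _ _ _))

    big-∙-distrib : ∀ xs (f g : X → Carrier) → big xs (λ x → f x ∙ g x) ≈ big xs f ∙ big xs g
    big-∙-distrib []       f g = sym (identityˡ _)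
    big-∙-distrib (x ∷ xs) f g = trans (∙-congˡ (big-∙-distrib xs f g)) (interchange _ _ _ _)

    big-filterᵇ : ∀ (p : X → Bool) xs (f : X → Carrier) →
                  big (filterᵇ p xs) f ≈ big xs (λ x → if p x then f x else ε)
    big-filterᵇ p []       f = refl
    big-filterᵇ p (x ∷ xs) f with p x
    ... | true  = ∙-congˡ (big-filterᵇ p xs f)
    ... | false = trans (big-filterᵇ p xs f) (sym (identityˡ _))

  big-─ : ∀ {a p} {X : Set a} {P : X → Set p} (ys : List X) (y∈ys : Any P ys) (f : X → Carrier) →
          big ys f ≈ f (lookup y∈ys) ∙ big (ys ─ y∈ys) f
  big-─ (y ∷ ys) (here _)     f = refl
  big-─ (y ∷ ys) (there y∈ys) f = trans (∙-congˡ (big-─ ys y∈ys f)) (x∙yz≈y∙xz _ _ _)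

  big-map : ∀ {a b} {X : Set a} {Y : Set b} (φ : X → Y) xs (f : Y → Carrier) →
            big (map φ xs) f ≡ big xs (f ∘ φ)
  big-map φ []       f = ≡.refl
  big-map φ (x ∷ xs) f = ≡.cong (f (φ x) ∙_) (big-map φ xs f)

  big-tabulate : ∀ {a n} {X : Set a} (h : Fin n → X) (f : X → Carrier) →
                 big (tabulate h) f ≡ big (allFin n) (f ∘ h)
  big-tabulate {n = 0}     h f = ≡.refl
  big-tabulate {n = suc n} h f =
    ≡.cong (f (h zero) ∙_) (≡.trans (big-tabulate (h ∘ suc) f) (≡.sym (big-tabulate suc (f ∘ h))))

  big-allFin-suc : ∀ {n} (f : Fin (suc n) → Carrier) → big (allFin (suc n)) f ≡ f zero ∙ big (allFin n) (f ∘ suc)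
  big-allFin-suc f = ≡.cong (f zero ∙_) (big-tabulate suc f)

  big-concat : ∀ {a} {X : Set a} (xss : List (List X)) (f : X → Carrier) →
               big (concat xss) f ≈ big xss (λ xs → big xs f)
  big-concat []         f = refl
  big-concat (xs ∷ xss) f = trans (big-++ xs (concat xss) f) (∙-congˡ (big-concat xss f))

  big-concatMap : ∀ {a b} {X : Set a} {Y : Set b} (h : X → List Y) xs (f : Y → Carrier) →
                  big (concatMap h xs) f ≈ big xs (λ x → big (h x) f)
  big-concatMap h xs f = trans (big-concat (map h xs) f) (reflexive (big-map h xs (λ ys → big ys f)))

  big-comm : ∀ {a b} {X : Set a} {Y : Set b} xs ys (f : X → Y → Carrier) →
             big xs (λ x → big ys (f x)) ≈ big ys (λ y → big xs (λ x → f x y))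
  big-comm []       ys f = sym (big-ε ys)
  big-comm (x ∷ xs) ys f =
    trans (∙-congˡ (big-comm xs ys f)) (sym (big-∙-distrib ys (f x) (λ y → big xs (λ x → f x y))))


⟦_⟧ : Bool → ℕ
⟦ true  ⟧ = 1
⟦ false ⟧ = 0

module ℕΣ = Big ℕ.+-0-commutativeMonoid

module Multiplicity {a e} (D : DecSetoid a e) where
  open DecSetoid D renaming (Carrier to X; _≈_ to _≃_; _≟_ to _≃?_)

  multiplicity : X → List X → ℕ
  multiplicity z xs = ℕΣ.big xs (λ x → ⟦ does (z ≃? x) ⟧)

  Enumerates : List X → Set a
  Enumerates xs = ∀ z → multiplicity z xs ≡ 1

  ⟦≃?⟧-congʳ : ∀ z {x y} → x ≃ y → ⟦ does (z ≃? x) ⟧ ≡ ⟦ does (z ≃? y) ⟧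
  ⟦≃?⟧-congʳ z {x} {y} x≃y with z ≃? x | z ≃? y
  ... | yes _   | yes _   = ≡.refl
  ... | no _    | no _    = ≡.refl
  ... | yes z≃x | no z≄y  = ⊥-elim (z≄y (trans z≃x x≃y))
  ... | no z≄x  | yes z≃y = ⊥-elim (z≄x (trans z≃y (sym x≃y)))

  multiplicity-here : ∀ z xs → multiplicity z (z ∷ xs) ≡ suc (multiplicity z xs)
  multiplicity-here z xs with z ≃? z
  ... | yes _  = ≡.refl
  ... | no z≄z = ⊥-elim (z≄z refl)

  multiplicity≢0⇒∈ : ∀ z xs → multiplicity z xs ≢ 0 → Any (z ≃_) xs
  multiplicity≢0⇒∈ z []       m≢0 = ⊥-elim (m≢0 ≡.refl)
  multiplicity≢0⇒∈ z (x ∷ xs) m≢0 with z ≃? x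
  ... | yes z≃x = here z≃x
  ... | no _    = there (multiplicity≢0⇒∈ z xs m≢0)

  -- z ≃ φ x holds exactly when ψ z ≃ x, so φ permutes the multiplicities.
  multiplicity-map : ∀ {φ ψ : X → X} → Inverseᵇ _≃_ _≃_ φ ψ →
                     ∀ z xs → multiplicity z (map φ xs) ≡ multiplicity (ψ z) xs
  multiplicity-map {φ} {ψ} (invˡ , invʳ) z xs =
    ≡.trans (ℕΣ.big-map φ xs _) (ℕΣ.big-cong xs δ-map)
    where
    δ-map : ∀ x → ⟦ does (z ≃? φ x) ⟧ ≡ ⟦ does (ψ z ≃? x) ⟧
    δ-map x with z ≃? φ x | ψ z ≃? x
    ... | yes _     | yes _     = ≡.refl
    ... | no _      | no _      = ≡.refl
    ... | yes z≃φx  | no ψz≄x   = ⊥-elim (ψz≄x (invʳ z≃φx))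
    ... | no z≄φx   | yes ψz≃x  = ⊥-elim (z≄φx (sym (invˡ (sym ψz≃x))))

  map-enumerates : ∀ {φ ψ : X → X} → Inverseᵇ _≃_ _≃_ φ ψ →
                   ∀ {xs} → Enumerates xs → Enumerates (map φ xs)
  map-enumerates inv {xs} enum z = ≡.trans (multiplicity-map inv z xs) (enum _)

module BigMultiplicity {c ℓ a e} (M : CommutativeMonoid c ℓ) (D : DecSetoid a e) where
  open import Data.Nat using (_+_)
  open Multiplicity D
  open DecSetoid D using () renaming (Carrier to X; _≈_ to _≃_; _≟_ to _≃?_)
  open CommutativeMonoid M using (_∙_; ∙-cong)
    renaming (Carrier to C; _≈_ to _≈ᴹ_; refl to reflᴹ; trans to transᴹ; sym to symᴹ; reflexive to reflexiveᴹ)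
  open Big M

  big-multiplicity : ∀ (xs ys : List X) → (∀ z → multiplicity z xs ≡ multiplicity z ys) →
                     (f : X → C) → Congruent _≃_ _≈ᴹ_ f → big xs f ≈ᴹ big ys f
  big-multiplicity []       []       _  f f-cong = reflᴹ
  big-multiplicity []       (y ∷ ys) eq f f-cong =
    ⊥-elim (ℕ.0≢1+n (≡.trans (eq y) (multiplicity-here y ys)))
  big-multiplicity (x ∷ xs) ys       eq f f-cong =
    transᴹ (∙-cong (f-cong x≃y) (big-multiplicity xs (ys ─ x∈ys) eq′ f f-cong)) (symᴹ (big-─ ys x∈ys f))
    where
    x∈ys : Any (x ≃_) ys
    x∈ys = multiplicity≢0⇒∈ x ys λ m≡0 →
      ℕ.1+n≢0 (≡.trans (≡.sym (multiplicity-here x xs)) (≡.trans (eq x) m≡0))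
    x≃y : x ≃ lookup x∈ys
    x≃y = lookup-result x∈ys
    eq′ : ∀ z → multiplicity z xs ≡ multiplicity z (ys ─ x∈ys)
    eq′ z = ℕ.+-cancelˡ-≡ ⟦ does (z ≃? x) ⟧ _ _ (begin
      ⟦ does (z ≃? x) ⟧ + multiplicity z xs
        ≡⟨ eq z ⟩
      multiplicity z ys
        ≡⟨ ℕΣ.big-─ ys x∈ys _ ⟩
      ⟦ does (z ≃? lookup x∈ys) ⟧ + multiplicity z (ys ─ x∈ys)
        ≡⟨ ≡.cong (_+ multiplicity z (ys ─ x∈ys)) (≡.sym (⟦≃?⟧-congʳ z x≃y)) ⟩
      ⟦ does (z ≃? x) ⟧ + multiplicity z (ys ─ x∈ys) ∎)
      where open ≡.≡-Reasoning

  big-reindex : ∀ xs → Enumerates xs → ∀ {φ ψ : X → X} → Inverseᵇ _≃_ _≃_ φ ψ →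
                (f : X → C) → Congruent _≃_ _≈ᴹ_ f → big xs (f ∘ φ) ≈ᴹ big xs f
  big-reindex xs enum {φ} inv f f-cong = transᴹ (reflexiveᴹ (≡.sym (big-map φ xs f)))
    (big-multiplicity (map φ xs) xs (λ z → ≡.trans (map-enumerates inv {xs} enum z) (≡.sym (enum z)))
                      f f-cong)


_≗?_ : ∀ {n m} → Decidable (_≗_ {A = Fin n} {B = Fin m})
_≗?_ {zero}  f g = yes λ ()
_≗?_ {suc n} f g =
  map′ (uncurry cons) (λ f≗g → f≗g zero , f≗g ∘ suc) ((f zero ≟ g zero) ×-dec ((f ∘ suc) ≗? (g ∘ suc)))
  where
  cons : f zero ≡ g zero → f ∘ suc ≗ g ∘ suc → f ≗ g
  cons eq₀ eqₛ zero    = eq₀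
  cons eq₀ eqₛ (suc i) = eqₛ i

≗-decSetoid : ℕ → ℕ → DecSetoid 0ℓ 0ℓ
≗-decSetoid n m = record
  { Carrier = Fin n → Fin m
  ; _≈_ = _≗_
  ; isDecEquivalence = record
    { isEquivalence = record
      { refl  = λ _ → ≡.refl
      ; sym   = λ f≗g i → ≡.sym (f≗g i)
      ; trans = λ f≗g g≗h i → ≡.trans (f≗g i) (g≗h i)
      }
    ; _≟_ = _≗?_ } }

allFin-enumerates : ∀ n → Multiplicity.Enumerates (≡-decSetoid n) (allFin n)
allFin-enumerates (suc n) zero    =
  ≡.trans (ℕΣ.big-allFin-suc {n} (λ x → ⟦ does (zero ≟ x) ⟧)) (≡.cong suc (ℕΣ.big-ε (allFin n)))
allFin-enumerates (suc n) (suc z) =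
  ≡.trans (ℕΣ.big-allFin-suc {n} (λ x → ⟦ does (suc z ≟ x) ⟧)) (allFin-enumerates n z)

big-allFin-≟-∧ : ∀ {n} (z : Fin n) (c : Bool) → ℕΣ.big (allFin n) (λ j → ⟦ does (z ≟ j) ∧ c ⟧) ≡ ⟦ c ⟧
big-allFin-≟-∧ {n} z true  =
  ≡.trans (ℕΣ.big-cong (allFin n) (λ j → ≡.cong ⟦_⟧ (∧-identityʳ _))) (allFin-enumerates n z)
big-allFin-≟-∧ {n} z false =
  ≡.trans (ℕΣ.big-cong (allFin n) (λ j → ≡.cong ⟦_⟧ (∧-zeroʳ _))) (ℕΣ.big-ε (allFin n))

allFuns-enumerates : ∀ n m → Multiplicity.Enumerates (≗-decSetoid n m) (allFuns n m)
allFuns-enumerates zero    m g = ≡.refl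
allFuns-enumerates (suc n) m g = begin
  ℕΣ.big (concatMap (λ f → map (_◂ f) (allFin m)) (allFuns n m)) (λ f → ⟦ does (g ≗? f) ⟧)
    ≡⟨ ℕΣ.big-concatMap (λ f → map (_◂ f) (allFin m)) (allFuns n m) _ ⟩
  ℕΣ.big (allFuns n m) (λ f → ℕΣ.big (map (_◂ f) (allFin m)) (λ f → ⟦ does (g ≗? f) ⟧))
    ≡⟨ ℕΣ.big-cong (allFuns n m) (λ f → ≡.trans (ℕΣ.big-map (_◂ f) (allFin m) _) (big-allFin-≟-∧ (g zero) _)) ⟩
  ℕΣ.big (allFuns n m) (λ f → ⟦ does ((g ∘ suc) ≗? f) ⟧)
    ≡⟨ allFuns-enumerates n m (g ∘ suc) ⟩
  1 ∎
  where
  open ≡.≡-Reasoning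


injective⇒surjective : ∀ {n} {σ : Fin n → Fin n} → Injective _≡_ _≡_ σ → ∀ y → ∃ λ x → σ x ≡ y
injective⇒surjective {suc m} {σ} σ-inj y with any? (λ x → σ x ≟ y)
... | yes σx≡y = σx≡y
... | no ∄x = ⊥-elim (ℕ.<-irrefl ≡.refl (injective⇒≤ punchOut-y-injective))
  where
  y≢σ : ∀ x → y ≢ σ x
  y≢σ x y≡σx = ∄x (x , ≡.sym y≡σx)
  punchOut-y-injective : Injective _≡_ _≡_ (λ x → punchOut (y≢σ x))
  punchOut-y-injective {x} {x′} eq = σ-inj (punchOut-injective (y≢σ x) (y≢σ x′) eq)

and-true⇔ : ∀ (bs : List Bool) → and bs ≡ true ⇔ (∀ {b} → b ∈ bs → b ≡ true)
and-true⇔ bs = mk⇔ (elim bs) (intro bs)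
  where
  elim : ∀ bs → and bs ≡ true → ∀ {b} → b ∈ bs → b ≡ true
  elim (true ∷ bs) and≡true (here ≡.refl) = ≡.refl
  elim (true ∷ bs) and≡true (there b∈bs)  = elim bs and≡true b∈bs
  intro : ∀ bs → (∀ {b} → b ∈ bs → b ≡ true) → and bs ≡ true
  intro []       _   = ≡.refl
  intro (b ∷ bs) all with all (here ≡.refl)
  ... | ≡.refl = intro bs (all ∘ there)

true⇔true⇒≡ : ∀ {a b : Bool} → (a ≡ true → b ≡ true) → (b ≡ true → a ≡ true) → a ≡ b
true⇔true⇒≡ {true}          a⇒b _   = ≡.sym (a⇒b ≡.refl)
true⇔true⇒≡ {false} {true}  _   b⇒a = b⇒a ≡.refl
true⇔true⇒≡ {false} {false} _   _   = ≡.refl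

module _ {n : ℕ} where
  private variable
    σ τ π : Fin n → Fin n

  _⁻¹ : (Fin n → Fin n) → Fin n → Fin n
  (σ ⁻¹) y with any? (λ x → σ x ≟ y)
  ... | yes (x , _) = x
  ... | no _        = y

  ⁻¹-inverseʳ : Injective _≡_ _≡_ σ → ∀ y → σ ((σ ⁻¹) y) ≡ y
  ⁻¹-inverseʳ {σ} σ-inj y with any? (λ x → σ x ≟ y)
  ... | yes (x , σx≡y) = σx≡y
  ... | no ∄x = ⊥-elim (∄x (injective⇒surjective σ-inj y))

  ⁻¹-inverseˡ : Injective _≡_ _≡_ σ → ∀ x → (σ ⁻¹) (σ x) ≡ x
  ⁻¹-inverseˡ σ-inj x = σ-inj (⁻¹-inverseʳ σ-inj _)

  ⁻¹-injective : Injective _≡_ _≡_ σ → Injective _≡_ _≡_ (σ ⁻¹)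
  ⁻¹-injective {σ} σ-inj {y} {y′} eq =
    ≡.trans (≡.sym (⁻¹-inverseʳ σ-inj y)) (≡.trans (≡.cong σ eq) (⁻¹-inverseʳ σ-inj y′))

  ⁻¹-involutive : Injective _≡_ _≡_ σ → (σ ⁻¹) ⁻¹ ≗ σ
  ⁻¹-involutive σ-inj x = ⁻¹-injective σ-inj
    (≡.trans (⁻¹-inverseʳ (⁻¹-injective σ-inj) x) (≡.sym (⁻¹-inverseˡ σ-inj x)))

  ≗-injective : σ ≗ τ → Injective _≡_ _≡_ σ → Injective _≡_ _≡_ τ
  ≗-injective σ≗τ σ-inj {x} {x′} eq = σ-inj (≡.trans (σ≗τ x) (≡.trans eq (≡.sym (σ≗τ x′))))

  ⁻¹-cong : Injective _≡_ _≡_ σ → σ ≗ τ → σ ⁻¹ ≗ τ ⁻¹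
  ⁻¹-cong σ-inj σ≗τ y =
    σ-inj (≡.trans (⁻¹-inverseʳ σ-inj y) (≡.sym (≡.trans (σ≗τ _) (⁻¹-inverseʳ (≗-injective σ≗τ σ-inj) y))))

  and-pairs⇔ : ∀ (b : Fin n → Fin n → Bool) →
               and (concatMap (λ i → map (b i) (allFin n)) (allFin n)) ≡ true ⇔ (∀ i j → b i j ≡ true)
  and-pairs⇔ b = mk⇔
    (λ and≡true i j → Equivalence.to (and-true⇔ _) and≡true
       (∈-concatMap⁺ row (Any.map (λ { ≡.refl → ∈-map⁺ (b i) (∈-allFin j) }) (∈-allFin i))))
    (λ all → Equivalence.from (and-true⇔ _) λ b∈ →
       let i , b∈row = Any.satisfied (∈-concatMap⁻ row {xs = allFin n} b∈)
           j , _ , b≡bij = ∈-map⁻ (b i) b∈row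
       in ≡.trans b≡bij (all i j))
    where
    row : Fin n → List Bool
    row i = map (b i) (allFin n)

  isPermᵇ⇔injective : isPermᵇ σ ≡ true ⇔ Injective _≡_ _≡_ σ
  isPermᵇ⇔injective {σ} = mk⇔
    (λ isPerm {i} {j} → from-pair i j (Equivalence.to (and-pairs⇔ pair) isPerm i j))
    (λ σ-inj → Equivalence.from (and-pairs⇔ pair) λ i j → to-pair i j σ-inj)
    where
    pair : Fin n → Fin n → Bool
    pair i j = not ⌊ σ i ≟ σ j ⌋ ∨ ⌊ i ≟ j ⌋
    from-pair : ∀ i j → pair i j ≡ true → σ i ≡ σ j → i ≡ j
    from-pair i j pair≡true σi≡σj with σ i ≟ σ j | i ≟ j
    ... | _        | yes i≡j = i≡j
    ... | no σi≢σj | no _    = ⊥-elim (σi≢σj σi≡σj)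
    to-pair : ∀ i j → Injective _≡_ _≡_ σ → pair i j ≡ true
    to-pair i j σ-inj with σ i ≟ σ j | i ≟ j
    ... | no _      | _      = ≡.refl
    ... | yes _     | yes _  = ≡.refl
    ... | yes σi≡σj | no i≢j = ⊥-elim (i≢j (σ-inj σi≡σj))

  isPermᵇ⇒injective : isPermᵇ σ ≡ true → Injective _≡_ _≡_ σ
  isPermᵇ⇒injective = Equivalence.to isPermᵇ⇔injective

  injective⇒isPermᵇ : Injective _≡_ _≡_ σ → isPermᵇ σ ≡ true
  injective⇒isPermᵇ = Equivalence.from isPermᵇ⇔injective

  isPermᵇ-resp : (Injective _≡_ _≡_ σ → Injective _≡_ _≡_ τ) →
                 (Injective _≡_ _≡_ τ → Injective _≡_ _≡_ σ) →
                 isPermᵇ σ ≡ isPermᵇ τ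
  isPermᵇ-resp σ⇒τ τ⇒σ = true⇔true⇒≡ (injective⇒isPermᵇ ∘ σ⇒τ ∘ isPermᵇ⇒injective)
                                      (injective⇒isPermᵇ ∘ τ⇒σ ∘ isPermᵇ⇒injective)

  isPermᵇ-cong : σ ≗ τ → isPermᵇ σ ≡ isPermᵇ τ
  isPermᵇ-cong σ≗τ = isPermᵇ-resp (≗-injective σ≗τ) (≗-injective (≡.sym ∘ σ≗τ))

  isPermᵇ-∘ʳ : Injective _≡_ _≡_ π → isPermᵇ (σ ∘ π) ≡ isPermᵇ σ
  isPermᵇ-∘ʳ {π} {σ} π-inj = isPermᵇ-resp (λ σπ-inj → σ-injective σπ-inj) (λ σ-inj → π-inj ∘ σ-inj)
    where
    σ-injective : Injective _≡_ _≡_ (σ ∘ π) → Injective _≡_ _≡_ σ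
    σ-injective σπ-inj {x} {y} σx≡σy = begin
      x                ≡⟨ ⁻¹-inverseʳ π-inj x ⟨
      π ((π ⁻¹) x)     ≡⟨ ≡.cong π (σπ-inj (≡.trans (≡.cong σ (⁻¹-inverseʳ π-inj x))
                                             (≡.trans σx≡σy (≡.sym (≡.cong σ (⁻¹-inverseʳ π-inj y)))))) ⟩
      π ((π ⁻¹) y)     ≡⟨ ⁻¹-inverseʳ π-inj y ⟩
      y                ∎
      where open ≡.≡-Reasoning

  isPermᵇ≡false⇒collision : isPermᵇ σ ≡ false → ∃₂ λ a b → a < b × σ a ≡ σ b
  isPermᵇ≡false⇒collision {σ} ¬perm with any? (λ a → any? (λ b → (a <? b) ×-dec (σ a ≟ σ b)))
  ... | yes collision = collision
  ... | no ∄collision with ≡.trans (≡.sym ¬perm) (injective⇒isPermᵇ σ-inj)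
    where
    σ-inj : Injective _≡_ _≡_ σ
    σ-inj {i} {j} σi≡σj with <-cmp i j
    ... | tri< i<j _ _ = ⊥-elim (∄collision (i , j , i<j , σi≡σj))
    ... | tri≈ _ i≡j _ = i≡j
    ... | tri> _ _ j<i = ⊥-elim (∄collision (j , i , j<i , ≡.sym σi≡σj))
  ... | ()

  module _ {a b : Fin n} where

    transpose-injective : Injective _≡_ _≡_ (transpose a b)
    transpose-injective eq =
      ≡.trans (≡.sym (transpose-inverse b a)) (≡.trans (≡.cong (transpose b a) eq) (transpose-inverse b a))

    transpose-matchˡ : transpose a b a ≡ b
    transpose-matchˡ with a ≟ a
    ... | yes _   = ≡.refl
    ... | no a≢a = ⊥-elim (a≢a ≡.refl)

    transpose-matchʳ : transpose a b b ≡ a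
    transpose-matchʳ with b ≟ a
    ... | yes b≡a = b≡a
    ... | no _ with b ≟ b
    ...   | yes _   = ≡.refl
    ...   | no b≢b = ⊥-elim (b≢b ≡.refl)

    transpose-mismatch : ∀ {i} → a ≢ i → b ≢ i → transpose a b i ≡ i
    transpose-mismatch {i} a≢i b≢i with i ≟ a
    ... | yes i≡a = ⊥-elim (a≢i (≡.sym i≡a))
    ... | no _ with i ≟ b
    ...   | yes i≡b = ⊥-elim (b≢i (≡.sym i≡b))
    ...   | no _    = ≡.refl

Perms-isPermᵇ : ∀ n → All (λ σ → isPermᵇ σ ≡ true) (Perms n)
Perms-isPermᵇ n = All.map (Equivalence.to T-≡) (all-filter (T? ∘ isPermᵇ) (allFuns n n))

⁻¹-Inverseᵇ : ∀ {n} {π : Fin n → Fin n} → Injective _≡_ _≡_ π → Inverseᵇ _≡_ _≡_ π (π ⁻¹)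
⁻¹-Inverseᵇ {π = π} π-inj =
  Consequences.strictlyInverseˡ⇒inverseˡ π (⁻¹-inverseʳ π-inj) ,
  Consequences.strictlyInverseʳ⇒inverseʳ π (⁻¹-inverseˡ π-inj)

module _ {n : ℕ} where
  open import Function.Consequences.Setoid (DecSetoid.setoid (≗-decSetoid n n)) (DecSetoid.setoid (≗-decSetoid n n))

  ≗-Inverseᵇ : ∀ {Φ Ψ : (Fin n → Fin n) → (Fin n → Fin n)} →
               (∀ {σ τ} → σ ≗ τ → Φ σ ≗ Φ τ) → (∀ {σ τ} → σ ≗ τ → Ψ σ ≗ Ψ τ) →
               (∀ σ → Φ (Ψ σ) ≗ σ) → (∀ σ → Ψ (Φ σ) ≗ σ) → Inverseᵇ _≗_ _≗_ Φ Ψ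
  ≗-Inverseᵇ Φ-cong Ψ-cong ΦΨ ΨΦ =
    strictlyInverseˡ⇒inverseˡ Φ-cong ΦΨ , strictlyInverseʳ⇒inverseʳ Ψ-cong ΨΦ

module Reindex {c ℓ} (M : CommutativeMonoid c ℓ) where
  open CommutativeMonoid M renaming (Carrier to C)
  open Big M

  big-allFin-reindex : ∀ {n} {π : Fin n → Fin n} → Injective _≡_ _≡_ π → (f : Fin n → C) →
                       big (allFin n) (f ∘ π) ≈ big (allFin n) f
  big-allFin-reindex {n} π-inj f =
    BigMultiplicity.big-reindex M (≡-decSetoid n) (allFin n) (allFin-enumerates n) (⁻¹-Inverseᵇ π-inj)
                                f (reflexive ∘ ≡.cong f)

  module _ {n : ℕ} where

    guarded : ((Fin n → Fin n) → C) → (Fin n → Fin n) → C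
    guarded g σ = if isPermᵇ σ then g σ else ε

    big-Perms : ∀ (g : (Fin n → Fin n) → C) → big (Perms n) g ≈ big (allFuns n n) (guarded g)
    big-Perms g = big-filterᵇ isPermᵇ (allFuns n n) g

    big-Perms-reindex : ∀ {Φ Ψ : (Fin n → Fin n) → (Fin n → Fin n)} →
      Inverseᵇ _≗_ _≗_ Φ Ψ → (∀ σ → isPermᵇ (Φ σ) ≡ isPermᵇ σ) →
      (g : (Fin n → Fin n) → C) → Congruent _≗_ _≈_ g →
      big (Perms n) (g ∘ Φ) ≈ big (Perms n) g
    big-Perms-reindex {Φ} inv Φ-isPermᵇ g g-cong = begin
      big (Perms n) (g ∘ Φ)
        ≈⟨ big-Perms (g ∘ Φ) ⟩
      big (allFuns n n) (guarded (g ∘ Φ))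
        ≈⟨ big-cong (allFuns n n) (λ σ → reflexive (≡.cong (λ b → if b then g (Φ σ) else ε)
                                                           (≡.sym (Φ-isPermᵇ σ)))) ⟩
      big (allFuns n n) (guarded g ∘ Φ)
        ≈⟨ BigMultiplicity.big-reindex M (≗-decSetoid n n) (allFuns n n) (allFuns-enumerates n n)
                                       inv (guarded g) guarded-cong ⟩
      big (allFuns n n) (guarded g)
        ≈⟨ sym (big-Perms g) ⟩
      big (Perms n) g ∎
      where
      open import Relation.Binary.Reasoning.Setoid setoid
      guarded-cong : ∀ {σ τ} → σ ≗ τ → guarded g σ ≈ guarded g τ
      guarded-cong {σ} {τ} σ≗τ rewrite ≡.sym (isPermᵇ-cong σ≗τ) with isPermᵇ σ in σ-perm
      ... | true  = g-cong σ≗τ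
      ... | false = refl

    big-Perms-∘ʳ : ∀ {π : Fin n → Fin n} → Injective _≡_ _≡_ π →
      (g : (Fin n → Fin n) → C) → Congruent _≗_ _≈_ g →
      big (Perms n) (λ σ → g (σ ∘ π)) ≈ big (Perms n) g
    big-Perms-∘ʳ {π} π-inj = big-Perms-reindex
      (≗-Inverseᵇ (λ σ≗τ → σ≗τ ∘ π) (λ σ≗τ → σ≗τ ∘ (π ⁻¹))
                  (λ σ → ≡.cong σ ∘ ⁻¹-inverseˡ π-inj) (λ σ → ≡.cong σ ∘ ⁻¹-inverseʳ π-inj))
      (λ σ → isPermᵇ-∘ʳ π-inj)

    big-Perms-⁻¹ : (g : (Fin n → Fin n) → C) → Congruent _≗_ _≈_ g →
      big (Perms n) (λ σ → g (σ ⁻¹)) ≈ big (Perms n) g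
    big-Perms-⁻¹ g g-cong = trans
      (big-cong-All (Perms-isPermᵇ n) λ σ σ-perm →
         reflexive (≡.cong (λ b → g (inverseOnPerms b σ)) (≡.sym σ-perm)))
      (big-Perms-reindex inv Φ-isPermᵇ g g-cong)
      where
      -- σ ↦ σ ⁻¹ is an involution only on permutations, so it is extended by the identity.
      inverseOnPerms : Bool → (Fin n → Fin n) → (Fin n → Fin n)
      inverseOnPerms b σ = if b then σ ⁻¹ else σ
      Φ : (Fin n → Fin n) → (Fin n → Fin n)
      Φ σ = inverseOnPerms (isPermᵇ σ) σ
      ⁻¹-isPermᵇ : ∀ {σ : Fin n → Fin n} → isPermᵇ σ ≡ true → isPermᵇ (σ ⁻¹) ≡ true
      ⁻¹-isPermᵇ {σ} σ-perm = injective⇒isPermᵇ (⁻¹-injective (isPermᵇ⇒injective {σ = σ} σ-perm))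
      Φ-isPermᵇ : ∀ σ → isPermᵇ (Φ σ) ≡ isPermᵇ σ
      Φ-isPermᵇ σ with isPermᵇ σ in σ-perm
      ... | true  = ⁻¹-isPermᵇ σ-perm
      ... | false = σ-perm
      Φ-cong : ∀ {σ τ} → σ ≗ τ → Φ σ ≗ Φ τ
      Φ-cong {σ} {τ} σ≗τ rewrite ≡.sym (isPermᵇ-cong σ≗τ) with isPermᵇ σ in σ-perm
      ... | true  = ⁻¹-cong (isPermᵇ⇒injective {σ = σ} σ-perm) σ≗τ
      ... | false = σ≗τ
      Φ-involutive : ∀ σ → Φ (Φ σ) ≗ σ
      Φ-involutive σ with isPermᵇ σ in σ-perm
      ... | true  = λ x → ≡.trans (≡.cong-app (≡.cong (λ b → inverseOnPerms b (σ ⁻¹)) (⁻¹-isPermᵇ σ-perm)) x)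
                                  (⁻¹-involutive (isPermᵇ⇒injective {σ = σ} σ-perm) x)
      ... | false = λ x → ≡.cong-app (≡.cong (λ b → inverseOnPerms b σ) σ-perm) x
      inv : Inverseᵇ _≗_ _≗_ Φ Φ
      inv = ≗-Inverseᵇ Φ-cong Φ-cong Φ-involutive Φ-involutive


module _ where
  open import Data.Nat using (_+_)

  module ℕReindex = Reindex ℕ.+-0-commutativeMonoid

  _<ᵇ_ : ∀ {n} → Fin n → Fin n → Bool
  i <ᵇ j = ⌊ i <? j ⌋

  <⇒<ᵇ : ∀ {n} {i j : Fin n} → i < j → i <ᵇ j ≡ true
  <⇒<ᵇ {i = i} {j} i<j with i <? j
  ... | yes _   = ≡.refl
  ... | no  i≮j = ⊥-elim (i≮j i<j)

  ≮⇒<ᵇ : ∀ {n} {i j : Fin n} → ¬ i < j → i <ᵇ j ≡ false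
  ≮⇒<ᵇ {i = i} {j} i≮j with i <? j
  ... | yes i<j = ⊥-elim (i≮j i<j)
  ... | no  _   = ≡.refl

  <ᵇ-irrefl : ∀ {n} (i : Fin n) → i <ᵇ i ≡ false
  <ᵇ-irrefl i = ≮⇒<ᵇ (<-irrefl ≡.refl)

  <ᵇ-flip : ∀ {n} {i j : Fin n} → i ≢ j → j <ᵇ i ≡ not (i <ᵇ j)
  <ᵇ-flip {i = i} {j} i≢j with <-cmp i j
  ... | tri< i<j _ j≮i = ≡.trans (≮⇒<ᵇ j≮i) (≡.cong not (≡.sym (<⇒<ᵇ i<j)))
  ... | tri≈ _ i≡j _   = ⊥-elim (i≢j i≡j)
  ... | tri> i≮j _ j<i = ≡.trans (<⇒<ᵇ j<i) (≡.cong not (≡.sym (≮⇒<ᵇ i≮j)))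

  <ᵇ-asym : ∀ {n} (i j : Fin n) → ⟦ i <ᵇ j ∧ j <ᵇ i ⟧ ≡ 0
  <ᵇ-asym i j with <-cmp i j
  ... | tri< i<j _ j≮i rewrite <⇒<ᵇ i<j | ≮⇒<ᵇ j≮i = ≡.refl
  ... | tri≈ i≮j _ _   rewrite ≮⇒<ᵇ i≮j = ≡.refl
  ... | tri> i≮j _ _   rewrite ≮⇒<ᵇ i≮j = ≡.refl

  pairSum : ∀ {n} → (Fin n → Fin n → ℕ) → ℕ
  pairSum {n} F = ℕΣ.big (allFin n) λ i → ℕΣ.big (allFin n) (F i)

  module _ {n : ℕ} where

    pairSum-cong : ∀ {F G : Fin n → Fin n → ℕ} → (∀ i j → F i j ≡ G i j) → pairSum F ≡ pairSum G
    pairSum-cong F≡G = ℕΣ.big-cong (allFin n) λ i → ℕΣ.big-cong (allFin n) (F≡G i)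

    pairSum-+ : ∀ (F G : Fin n → Fin n → ℕ) → pairSum (λ i j → F i j + G i j) ≡ pairSum F + pairSum G
    pairSum-+ F G = ≡.trans (ℕΣ.big-cong (allFin n) λ i → ℕΣ.big-∙-distrib (allFin n) (F i) (G i))
                            (ℕΣ.big-∙-distrib (allFin n) _ _)

    pairSum-comm : ∀ (F : Fin n → Fin n → ℕ) → pairSum F ≡ pairSum (λ i j → F j i)
    pairSum-comm F = ℕΣ.big-comm (allFin n) (allFin n) F

    pairSum-reindex : ∀ {π : Fin n → Fin n} → Injective _≡_ _≡_ π → (F : Fin n → Fin n → ℕ) →
                      pairSum (λ i j → F (π i) (π j)) ≡ pairSum F
    pairSum-reindex {π} π-inj F = ≡.trans (ℕΣ.big-cong (allFin n) λ i → ℕReindex.big-allFin-reindex π-inj (F (π i)))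
                                      (ℕReindex.big-allFin-reindex π-inj (λ i → ℕΣ.big (allFin n) (F i)))

  inversionCount : ∀ {n} → (Fin n → Fin n) → ℕ
  inversionCount σ = pairSum λ i j → ⟦ i <ᵇ j ∧ σ j <ᵇ σ i ⟧

  length-filterᵇ-id : ∀ (bs : List Bool) → length (filterᵇ id bs) ≡ ℕΣ.big bs ⟦_⟧
  length-filterᵇ-id []           = ≡.refl
  length-filterᵇ-id (true ∷ bs)  = ≡.cong suc (length-filterᵇ-id bs)
  length-filterᵇ-id (false ∷ bs) = length-filterᵇ-id bs

  inversions≡inversionCount : ∀ {n} (σ : Fin n → Fin n) → inversions σ ≡ inversionCount σ
  inversions≡inversionCount {n} σ = ≡.trans (length-filterᵇ-id (concatMap row (allFin n)))
    (≡.trans (ℕΣ.big-concatMap row (allFin n) ⟦_⟧)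
             (ℕΣ.big-cong (allFin n) λ i → ℕΣ.big-map (inverted i) (allFin n) ⟦_⟧))
    where
    inverted : Fin n → Fin n → Bool
    inverted i j = i <ᵇ j ∧ σ j <ᵇ σ i
    row : Fin n → List Bool
    row i = map (inverted i) (allFin n)

  inversionCount-cong : ∀ {n} {σ τ : Fin n → Fin n} → σ ≗ τ → inversionCount σ ≡ inversionCount τ
  inversionCount-cong σ≗τ = pairSum-cong λ i j → ≡.cong₂ (λ x y → ⟦ i <ᵇ j ∧ x <ᵇ y ⟧) (σ≗τ j) (σ≗τ i)

  inversionCount-id : ∀ {n} → inversionCount {n} id ≡ 0
  inversionCount-id {n} = ≡.trans (pairSum-cong {n} <ᵇ-asym)
    (≡.trans (ℕΣ.big-cong (allFin n) λ _ → ℕΣ.big-ε (allFin n)) (ℕΣ.big-ε (allFin n)))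

  split-< : ∀ {n} (i j : Fin n) (w : Bool) → (i ≡ j → w ≡ false) →
            ⟦ w ⟧ ≡ ⟦ i <ᵇ j ∧ w ⟧ + ⟦ j <ᵇ i ∧ w ⟧
  split-< i j w w-irrefl with <-cmp i j
  ... | tri< i<j _ j≮i rewrite <⇒<ᵇ i<j | ≮⇒<ᵇ j≮i = ≡.sym (ℕ.+-identityʳ _)
  ... | tri≈ _ ≡.refl _ rewrite w-irrefl ≡.refl | <ᵇ-irrefl i = ≡.refl
  ... | tri> i≮j _ j<i rewrite ≮⇒<ᵇ i≮j | <⇒<ᵇ j<i = ≡.refl

  -- For i < j, with p = [π i < π j] and q = [g j < g i], the three terms count p ∧ q, ¬p ∧ ¬q and ¬p.
  inversion-triple : ∀ p q → ⟦ p ∧ q ⟧ + ⟦ not p ∧ not q ⟧ + ⟦ not p ⟧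
                           ≡ ⟦ q ⟧ + (⟦ not p ∧ not q ⟧ + ⟦ not p ∧ not q ⟧)
  inversion-triple true  true  = ≡.refl
  inversion-triple true  false = ≡.refl
  inversion-triple false true  = ≡.refl
  inversion-triple false false = ≡.refl

  module _ {n : ℕ} {σ π : Fin n → Fin n} (σ-inj : Injective _≡_ _≡_ σ) (π-inj : Injective _≡_ _≡_ π) where
    private
      g : Fin n → Fin n
      g = σ ∘ π
      W : Fin n → Fin n → Bool
      W i j = π i <ᵇ π j ∧ g j <ᵇ g i
      W-irrefl : ∀ i j → i ≡ j → W i j ≡ false
      W-irrefl i _ ≡.refl = ≡.cong (_∧ g i <ᵇ g i) (<ᵇ-irrefl (π i))
      invertedByπOnly : Fin n → Fin n → ℕ
      invertedByπOnly i j = ⟦ i <ᵇ j ∧ (π j <ᵇ π i ∧ g i <ᵇ g j) ⟧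
      pointwise : ∀ i j → ⟦ i <ᵇ j ∧ W i j ⟧ + ⟦ i <ᵇ j ∧ W j i ⟧ + ⟦ i <ᵇ j ∧ π j <ᵇ π i ⟧
                        ≡ ⟦ i <ᵇ j ∧ g j <ᵇ g i ⟧ + (invertedByπOnly i j + invertedByπOnly i j)
      pointwise i j with <-cmp i j
      ... | tri≈ i≮j _ _ rewrite ≮⇒<ᵇ i≮j = ≡.refl
      ... | tri> i≮j _ _ rewrite ≮⇒<ᵇ i≮j = ≡.refl
      ... | tri< i<j i≢j _ rewrite <⇒<ᵇ i<j
                                 | <ᵇ-flip {i = π i} {π j} (i≢j ∘ π-inj)
                                 | <ᵇ-flip {i = g j} {g i} (i≢j ∘ ≡.sym ∘ π-inj ∘ σ-inj)
        = inversion-triple (π i <ᵇ π j) (g j <ᵇ g i)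

    -- Relabelling by π, the inversions of σ become the pairs inverted by exactly one of π and σ ∘ π.
    inversionCount-∘ : ∃ λ e → inversionCount σ + inversionCount π ≡ inversionCount (σ ∘ π) + (e + e)
    inversionCount-∘ = pairSum invertedByπOnly , (begin
      inversionCount σ + inversionCount π
        ≡⟨ ≡.cong (_+ inversionCount π) (≡.sym (pairSum-reindex π-inj λ a b → ⟦ a <ᵇ b ∧ σ b <ᵇ σ a ⟧)) ⟩
      pairSum (λ i j → ⟦ W i j ⟧) + inversionCount π
        ≡⟨ ≡.cong (_+ inversionCount π) (≡.trans (pairSum-cong λ i j → split-< i j (W i j) (W-irrefl i j))
                                                  (pairSum-+ (λ i j → ⟦ i <ᵇ j ∧ W i j ⟧) _)) ⟩
      pairSum (λ i j → ⟦ i <ᵇ j ∧ W i j ⟧) + pairSum (λ i j → ⟦ j <ᵇ i ∧ W i j ⟧) + inversionCount π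
        ≡⟨ ≡.cong (λ x → pairSum (λ i j → ⟦ i <ᵇ j ∧ W i j ⟧) + x + inversionCount π) (pairSum-comm {n} _) ⟩
      pairSum (λ i j → ⟦ i <ᵇ j ∧ W i j ⟧) + pairSum (λ i j → ⟦ i <ᵇ j ∧ W j i ⟧) + inversionCount π
        ≡⟨ ≡.trans (≡.cong (_+ inversionCount π) (≡.sym (pairSum-+ {n} _ _))) (≡.sym (pairSum-+ {n} _ _)) ⟩
      pairSum (λ i j → ⟦ i <ᵇ j ∧ W i j ⟧ + ⟦ i <ᵇ j ∧ W j i ⟧ + ⟦ i <ᵇ j ∧ π j <ᵇ π i ⟧)
        ≡⟨ pairSum-cong pointwise ⟩
      pairSum (λ i j → ⟦ i <ᵇ j ∧ g j <ᵇ g i ⟧ + (invertedByπOnly i j + invertedByπOnly i j))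
        ≡⟨ ≡.trans (pairSum-+ {n} _ _)
                   (≡.cong (inversionCount g +_) (pairSum-+ invertedByπOnly invertedByπOnly)) ⟩
      inversionCount g + (pairSum invertedByπOnly + pairSum invertedByπOnly) ∎)
      where open ≡.≡-Reasoning

  module _ {n : ℕ} {a b : Fin n} (a<b : a < b) where
    private
      a≢b : a ≢ b
      a≢b a≡b = <-irrefl a≡b a<b
      inside : Fin n → Bool
      inside k = a <ᵇ k ∧ k <ᵇ b
      between : ℕ
      between = ℕΣ.big (allFin n) λ k → ⟦ inside k ⟧
      -- The inversions of (a b) are (a , b) and, for each a < k < b, the pairs (a , k) and (k , b).
      isAB aThenInside insideThenB : Fin n → Fin n → ℕ
      isAB i j        = ⟦ does (b ≟ j) ∧ does (a ≟ i) ⟧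
      aThenInside i j = ⟦ does (a ≟ i) ∧ inside j ⟧
      insideThenB i j = ⟦ does (b ≟ j) ∧ inside i ⟧
      outside-b : ∀ k → ⟦ b <ᵇ k ∧ k <ᵇ a ⟧ ≡ 0
      outside-b k with <-cmp b k
      ... | tri< b<k _ _ rewrite <⇒<ᵇ b<k | ≮⇒<ᵇ (<-asym (<-trans a<b b<k)) = ≡.refl
      ... | tri≈ b≮k _ _ rewrite ≮⇒<ᵇ b≮k = ≡.refl
      ... | tri> b≮k _ _ rewrite ≮⇒<ᵇ b≮k = ≡.refl
      outside-a : ∀ k → ⟦ k <ᵇ a ∧ b <ᵇ k ⟧ ≡ 0
      outside-a k = ≡.trans (≡.cong ⟦_⟧ (∧-comm (k <ᵇ a) (b <ᵇ k))) (outside-b k)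
      pointwise : ∀ i j → ⟦ i <ᵇ j ∧ transpose a b j <ᵇ transpose a b i ⟧
                        ≡ isAB i j + (aThenInside i j + insideThenB i j)
      pointwise i j with a ≟ i | b ≟ i | a ≟ j | b ≟ j
      ... | yes ≡.refl | yes ≡.refl | _          | _          = ⊥-elim (a≢b ≡.refl)
      ... | _          | _          | yes ≡.refl | yes ≡.refl = ⊥-elim (a≢b ≡.refl)
      ... | yes ≡.refl | no _       | yes ≡.refl | no _       rewrite <ᵇ-irrefl i = ≡.refl
      ... | yes ≡.refl | no _       | no _       | yes ≡.refl
        rewrite transpose-matchˡ {a = i} {j} | transpose-matchʳ {a = i} {j} | <⇒<ᵇ a<b | <ᵇ-irrefl i | <ᵇ-irrefl j
        = ≡.refl
      ... | yes ≡.refl | no _       | no a≢j     | no b≢j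
        rewrite transpose-matchˡ {a = i} {b} | transpose-mismatch a≢j b≢j = ≡.sym (ℕ.+-identityʳ _)
      ... | no _       | yes ≡.refl | yes ≡.refl | no _       rewrite ≮⇒<ᵇ (<-asym a<b) = ≡.refl
      ... | no _       | yes ≡.refl | no _       | yes ≡.refl rewrite <ᵇ-irrefl i | ∧-zeroʳ (a <ᵇ i) = ≡.refl
      ... | no _       | yes ≡.refl | no a≢j     | no b≢j
        rewrite transpose-matchʳ {a = a} {i} | transpose-mismatch a≢j b≢j = outside-b j
      ... | no a≢i     | no b≢i     | yes ≡.refl | no _
        rewrite transpose-matchˡ {a = j} {b} | transpose-mismatch a≢i b≢i = outside-a i
      ... | no a≢i     | no b≢i     | no _       | yes ≡.refl
        rewrite transpose-matchʳ {a = a} {j} | transpose-mismatch a≢i b≢i = ≡.cong ⟦_⟧ (∧-comm (i <ᵇ j) (a <ᵇ i))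
      ... | no a≢i     | no b≢i     | no a≢j     | no b≢j
        rewrite transpose-mismatch a≢i b≢i | transpose-mismatch a≢j b≢j = <ᵇ-asym i j

    inversionCount-transpose : ∃ λ e → inversionCount (transpose a b) ≡ suc (e + e)
    inversionCount-transpose = between , (begin
      inversionCount (transpose a b)
        ≡⟨ pairSum-cong pointwise ⟩
      pairSum (λ i j → isAB i j + (aThenInside i j + insideThenB i j))
        ≡⟨ ≡.trans (pairSum-+ isAB _) (≡.cong (pairSum isAB +_) (pairSum-+ aThenInside insideThenB)) ⟩
      pairSum isAB + (pairSum aThenInside + pairSum insideThenB)
        ≡⟨ ≡.cong₂ _+_ isAB-count (≡.cong₂ _+_ aThenInside-count insideThenB-count) ⟩
      suc (between + between) ∎)
      where
      open ≡.≡-Reasoning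
      isAB-count : pairSum isAB ≡ 1
      isAB-count = ≡.trans (ℕΣ.big-cong (allFin n) λ i → big-allFin-≟-∧ b (does (a ≟ i))) (allFin-enumerates n a)
      aThenInside-count : pairSum aThenInside ≡ between
      aThenInside-count =
        ≡.trans (pairSum-comm aThenInside) (ℕΣ.big-cong (allFin n) λ j → big-allFin-≟-∧ a (inside j))
      insideThenB-count : pairSum insideThenB ≡ between
      insideThenB-count = ℕΣ.big-cong (allFin n) λ i → big-allFin-≟-∧ b (inside i)

evenᵇ-suc : ∀ m → evenᵇ (suc m) ≡ not (evenᵇ m)
evenᵇ-suc zero          = ≡.refl
evenᵇ-suc (suc zero)    = ≡.refl
evenᵇ-suc (suc (suc m)) = evenᵇ-suc m

module Sign {c ℓ} (R : CommutativeRing c ℓ) where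
  open import Data.Nat using (_+_)
  open CommutativeRing R hiding (_+_; zero)
  open Over R
  open import Algebra.Properties.Ring ring using (-1*x≈-x; -‿involutive)
  open import Relation.Binary.Reasoning.Setoid setoid

  signOf : ℕ → Carrier
  signOf m = if evenᵇ m then 1# else - 1#

  -1*-1≈1 : - 1# * - 1# ≈ 1#
  -1*-1≈1 = trans (-1*x≈-x (- 1#)) (-‿involutive 1#)

  signOf-suc : ∀ m → signOf (suc m) ≈ - 1# * signOf m
  signOf-suc m rewrite evenᵇ-suc m with evenᵇ m
  ... | true  = sym (*-identityʳ (- 1#))
  ... | false = sym -1*-1≈1

  signOf-+ : ∀ m n → signOf (m + n) ≈ signOf m * signOf n
  signOf-+ zero    n = sym (*-identityˡ _)
  signOf-+ (suc m) n = begin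
    signOf (suc (m + n))          ≈⟨ signOf-suc (m + n) ⟩
    - 1# * signOf (m + n)         ≈⟨ *-congˡ (signOf-+ m n) ⟩
    - 1# * (signOf m * signOf n)  ≈⟨ sym (*-assoc _ _ _) ⟩
    - 1# * signOf m * signOf n    ≈⟨ *-congʳ (sym (signOf-suc m)) ⟩
    signOf (suc m) * signOf n     ∎

  signOf-square : ∀ m → signOf m * signOf m ≈ 1#
  signOf-square m with evenᵇ m
  ... | true  = *-identityˡ 1#
  ... | false = -1*-1≈1

  signOf-+-double : ∀ m e → signOf (m + (e + e)) ≈ signOf m
  signOf-+-double m e = begin
    signOf (m + (e + e))           ≈⟨ signOf-+ m (e + e) ⟩
    signOf m * signOf (e + e)      ≈⟨ *-congˡ (trans (signOf-+ e e) (signOf-square e)) ⟩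
    signOf m * 1#                  ≈⟨ *-identityʳ _ ⟩
    signOf m                       ∎

  sgn≡signOf : ∀ {n} (σ : Fin n → Fin n) → sgn σ ≡ signOf (inversionCount σ)
  sgn≡signOf σ = ≡.cong signOf (inversions≡inversionCount σ)

  sgn-cong : ∀ {n} {σ τ : Fin n → Fin n} → σ ≗ τ → sgn σ ≡ sgn τ
  sgn-cong {σ = σ} {τ} σ≗τ =
    ≡.trans (sgn≡signOf σ) (≡.trans (≡.cong signOf (inversionCount-cong σ≗τ)) (≡.sym (sgn≡signOf τ)))

  sgn-square : ∀ {n} (σ : Fin n → Fin n) → sgn σ * sgn σ ≈ 1#
  sgn-square σ rewrite sgn≡signOf σ = signOf-square (inversionCount σ)

  sgn-id : ∀ {n} → sgn {n} id ≈ 1#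
  sgn-id {n} rewrite sgn≡signOf {n} id | inversionCount-id {n} = refl

  sgn-∘ : ∀ {n} {σ π : Fin n → Fin n} → Injective _≡_ _≡_ σ → Injective _≡_ _≡_ π →
          sgn (σ ∘ π) ≈ sgn σ * sgn π
  sgn-∘ {σ = σ} {π} σ-inj π-inj with inversionCount-∘ σ-inj π-inj
  ... | e , parity rewrite sgn≡signOf σ | sgn≡signOf π | sgn≡signOf (σ ∘ π) = begin
    signOf (inversionCount (σ ∘ π))
      ≈⟨ sym (signOf-+-double (inversionCount (σ ∘ π)) e) ⟩
    signOf (inversionCount (σ ∘ π) + (e + e))
      ≡⟨ ≡.cong signOf (≡.sym parity) ⟩
    signOf (inversionCount σ + inversionCount π)
      ≈⟨ signOf-+ (inversionCount σ) (inversionCount π) ⟩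
    signOf (inversionCount σ) * signOf (inversionCount π) ∎

  sgn-transpose : ∀ {n} {a b : Fin n} → a < b → sgn (transpose a b) ≈ - 1#
  sgn-transpose {a = a} {b} a<b with inversionCount-transpose a<b
  ... | e , count rewrite sgn≡signOf (transpose a b) | count = begin
    signOf (suc (e + e))     ≈⟨ signOf-suc (e + e) ⟩
    - 1# * signOf (e + e)    ≈⟨ *-congˡ (signOf-+-double 0 e) ⟩
    - 1# * 1#                ≈⟨ *-identityʳ _ ⟩
    - 1#                     ∎

  sgn-⁻¹ : ∀ {n} {σ : Fin n → Fin n} → Injective _≡_ _≡_ σ → sgn (σ ⁻¹) ≈ sgn σ
  sgn-⁻¹ {n} {σ} σ-inj = begin
    sgn (σ ⁻¹)                          ≈⟨ sym (*-identityˡ _) ⟩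
    1# * sgn (σ ⁻¹)                     ≈⟨ *-congʳ (sym (sgn-square σ)) ⟩
    sgn σ * sgn σ * sgn (σ ⁻¹)          ≈⟨ *-assoc _ _ _ ⟩
    sgn σ * (sgn σ * sgn (σ ⁻¹))        ≈⟨ *-congˡ (sym (sgn-∘ σ-inj (⁻¹-injective σ-inj))) ⟩
    sgn σ * sgn (σ ∘ (σ ⁻¹))            ≡⟨ ≡.cong (sgn σ *_) (sgn-cong {n} {τ = id} (⁻¹-inverseʳ σ-inj)) ⟩
    sgn σ * sgn {n} id                  ≈⟨ *-congˡ (sgn-id {n}) ⟩
    sgn σ * 1#                          ≈⟨ *-identityʳ _ ⟩
    sgn σ                               ∎


module Determinant {c ℓ} (R : CommutativeRing c ℓ) where
  open CommutativeRing R hiding (zero)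
  open Over R
  open Sign R
  open import Algebra.Properties.Ring ring using (-1*x≈-x; -‿distribˡ-*)
  open import Relation.Binary.Reasoning.Setoid setoid
  module Σᴿ = Big +-commutativeMonoid
  module Πᴿ = Big *-commutativeMonoid
  module Σ-reindex = Reindex +-commutativeMonoid
  module Π-reindex = Reindex *-commutativeMonoid

  _ᵀ : ∀ {n} → Matrix n → Matrix n
  (A ᵀ) i j = A j i

  *-distribˡ-Σ : ∀ {a} {X : Set a} x (xs : List X) (f : X → Carrier) → x * Σ-list xs f ≈ Σ-list xs (λ y → x * f y)
  *-distribˡ-Σ x []       f = zeroʳ x
  *-distribˡ-Σ x (y ∷ xs) f = trans (distribˡ x (f y) _) (+-congˡ (*-distribˡ-Σ x xs f))

  *-distribʳ-Σ : ∀ {a} {X : Set a} x (xs : List X) (f : X → Carrier) → Σ-list xs f * x ≈ Σ-list xs (λ y → f y * x)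
  *-distribʳ-Σ x xs f = trans (*-comm _ x) (trans (*-distribˡ-Σ x xs f) (Σᴿ.big-cong xs (λ y → *-comm x (f y))))

  Π-cong : ∀ {n} {f g : Fin n → Carrier} → (∀ i → f i ≈ g i) → Π[< n ] f ≈ Π[< n ] g
  Π-cong {n} = Πᴿ.big-cong (allFin n)

  term : ∀ {n} → Matrix n → (Fin n → Fin n) → Carrier
  term {n} A σ = sgn σ * Π[< n ] λ i → A i (σ i)

  term-cong : ∀ {n} (A : Matrix n) → Congruent _≗_ _≈_ (term A)
  term-cong A σ≗τ = *-cong (reflexive (sgn-cong σ≗τ)) (Π-cong λ i → reflexive (≡.cong (A i) (σ≗τ i)))

  det-ᵀ : ∀ {n} (A : Matrix n) → det (A ᵀ) ≈ det A
  det-ᵀ {n} A = begin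
    Σ-list (Perms n) (term (A ᵀ))
      ≈⟨ Σᴿ.big-cong-All (Perms-isPermᵇ n) (λ σ → term-ᵀ ∘ isPermᵇ⇒injective {σ = σ}) ⟩
    Σ-list (Perms n) (λ σ → term A (σ ⁻¹))
      ≈⟨ Σ-reindex.big-Perms-⁻¹ (term A) (term-cong A) ⟩
    Σ-list (Perms n) (term A) ∎
    where
    term-ᵀ : ∀ {σ} → Injective _≡_ _≡_ σ → term (A ᵀ) σ ≈ term A (σ ⁻¹)
    term-ᵀ {σ} σ-inj = *-cong (sym (sgn-⁻¹ σ-inj)) (begin
      Π[< n ] (λ i → A (σ i) i)
        ≈⟨ Π-cong (λ i → reflexive (≡.cong (A (σ i)) (≡.sym (⁻¹-inverseˡ σ-inj i)))) ⟩
      Π[< n ] (λ i → A (σ i) ((σ ⁻¹) (σ i)))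
        ≈⟨ Π-reindex.big-allFin-reindex σ-inj (λ y → A y ((σ ⁻¹) y)) ⟩
      Π[< n ] (λ y → A y ((σ ⁻¹) y)) ∎)

  det-∘-rows : ∀ {n} (A : Matrix n) {f : Fin n → Fin n} → Injective _≡_ _≡_ f → det (A ∘ f) ≈ sgn f * det A
  det-∘-rows {n} A {f} f-inj = begin
    Σ-list (Perms n) (term (A ∘ f))
      ≈⟨ Σᴿ.big-cong (Perms n) (λ σ → *-congˡ (rows-back σ)) ⟩
    Σ-list (Perms n) h
      ≈⟨ Σ-reindex.big-Perms-∘ʳ f-inj h h-cong ⟨
    Σ-list (Perms n) (λ σ → h (σ ∘ f))
      ≈⟨ Σᴿ.big-cong-All (Perms-isPermᵇ n) (λ σ → h-∘ ∘ isPermᵇ⇒injective {σ = σ}) ⟩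
    Σ-list (Perms n) (λ σ → sgn f * term A σ)
      ≈⟨ *-distribˡ-Σ (sgn f) (Perms n) (term A) ⟨
    sgn f * det A ∎
    where
    h : (Fin n → Fin n) → Carrier
    h τ = sgn τ * Π[< n ] λ y → A y (τ ((f ⁻¹) y))
    h-cong : Congruent _≗_ _≈_ h
    h-cong σ≗τ = *-cong (reflexive (sgn-cong σ≗τ)) (Π-cong λ y → reflexive (≡.cong (A y) (σ≗τ _)))
    rows-back : ∀ σ → Π[< n ] (λ i → A (f i) (σ i)) ≈ Π[< n ] (λ y → A y (σ ((f ⁻¹) y)))
    rows-back σ = trans (Π-cong λ i → reflexive (≡.cong (A (f i) ∘ σ) (≡.sym (⁻¹-inverseˡ f-inj i))))
                        (Π-reindex.big-allFin-reindex f-inj (λ y → A y (σ ((f ⁻¹) y))))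
    h-∘ : ∀ {σ} → Injective _≡_ _≡_ σ → h (σ ∘ f) ≈ sgn f * term A σ
    h-∘ {σ} σ-inj = begin
      sgn (σ ∘ f) * Π[< n ] (λ y → A y (σ (f ((f ⁻¹) y))))
        ≈⟨ *-cong (sgn-∘ σ-inj f-inj) (Π-cong λ y → reflexive (≡.cong (A y ∘ σ) (⁻¹-inverseʳ f-inj y))) ⟩
      sgn σ * sgn f * Π[< n ] (λ y → A y (σ y))
        ≈⟨ *-congʳ (*-comm _ _) ⟩
      sgn f * sgn σ * Π[< n ] (λ y → A y (σ y))
        ≈⟨ *-assoc _ _ _ ⟩
      sgn f * term A σ ∎

  rows-transpose : ∀ {n} (A : Matrix n) {a b : Fin n} → A a ≗ A b → ∀ i → A (transpose a b i) ≗ A i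
  rows-transpose A {a} {b} Aa≗Ab i j with a ≟ i | b ≟ i
  ... | yes ≡.refl | _          = ≡.trans (≡.cong (λ k → A k j) (transpose-matchˡ {a = a} {b})) (≡.sym (Aa≗Ab j))
  ... | no _       | yes ≡.refl = ≡.trans (≡.cong (λ k → A k j) (transpose-matchʳ {a = a} {b})) (Aa≗Ab j)
  ... | no a≢i     | no b≢i     = ≡.cong (λ k → A k j) (transpose-mismatch a≢i b≢i)

  term-∘-transpose : ∀ {n} (A : Matrix n) {a b : Fin n} → a < b → A a ≗ A b →
                     ∀ {σ} → Injective _≡_ _≡_ σ → term A (σ ∘ transpose a b) ≈ - term A σ
  term-∘-transpose {n} A {a} {b} a<b Aa≗Ab {σ} σ-inj = begin
    sgn (σ ∘ s) * Π[< n ] (λ i → A i (σ (s i)))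
      ≈⟨ *-cong (sgn-∘ σ-inj s-inj) (Π-cong λ i → reflexive (≡.sym (rows-transpose A Aa≗Ab i (σ (s i))))) ⟩
    sgn σ * sgn s * Π[< n ] (λ i → A (s i) (σ (s i)))
      ≈⟨ *-cong (*-congˡ (sgn-transpose a<b)) (Π-reindex.big-allFin-reindex s-inj (λ i → A i (σ i))) ⟩
    sgn σ * - 1# * Π[< n ] (λ i → A i (σ i))
      ≈⟨ *-congʳ (trans (*-comm _ _) (-1*x≈-x _)) ⟩
    - sgn σ * Π[< n ] (λ i → A i (σ i))
      ≈⟨ -‿distribˡ-* _ _ ⟨
    - term A σ ∎
    where
    s : Fin n → Fin n
    s = transpose a b
    s-inj : Injective _≡_ _≡_ s
    s-inj = transpose-injective {a = a} {b}

  det-equal-rows : ∀ {n} (A : Matrix n) {a b : Fin n} → a < b → A a ≗ A b → det A ≈ 0#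
  det-equal-rows {n} A {a} {b} a<b Aa≗Ab = begin
    Σ-list (Perms n) (term A)
      ≈⟨ Σᴿ.big-cong (Perms n) split ⟩
    Σ-list (Perms n) (λ σ → K₁ σ + K₂ σ)
      ≈⟨ Σᴿ.big-∙-distrib (Perms n) K₁ K₂ ⟩
    Σ-list (Perms n) K₁ + Σ-list (Perms n) K₂
      ≈⟨ +-congˡ (Σ-reindex.big-Perms-∘ʳ s-inj K₂ K₂-cong) ⟨
    Σ-list (Perms n) K₁ + Σ-list (Perms n) (λ σ → K₂ (σ ∘ s))
      ≈⟨ Σᴿ.big-∙-distrib (Perms n) K₁ (λ σ → K₂ (σ ∘ s)) ⟨
    Σ-list (Perms n) (λ σ → K₁ σ + K₂ (σ ∘ s))
      ≈⟨ Σᴿ.big-cong-All (Perms-isPermᵇ n) (λ σ → cancel ∘ isPermᵇ⇒injective {σ = σ}) ⟩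
    Σ-list (Perms n) (λ _ → 0#)
      ≈⟨ Σᴿ.big-ε (Perms n) ⟩
    0# ∎
    where
    s : Fin n → Fin n
    s = transpose a b
    s-inj : Injective _≡_ _≡_ s
    s-inj = transpose-injective {a = a} {b}
    -- σ ↦ σ ∘ s negates the terms; splitting by σ a < σ b pairs them off without dividing by 2.
    u : (Fin n → Fin n) → Bool
    u σ = σ a <ᵇ σ b
    K₁ K₂ : (Fin n → Fin n) → Carrier
    K₁ σ = if u σ then term A σ else 0#
    K₂ σ = if u σ then 0# else term A σ
    split : ∀ σ → term A σ ≈ K₁ σ + K₂ σ
    split σ with u σ
    ... | true  = sym (+-identityʳ _)
    ... | false = sym (+-identityˡ _)
    K₂-cong : Congruent _≗_ _≈_ K₂
    K₂-cong {σ} {τ} σ≗τ rewrite ≡.cong₂ _<ᵇ_ (σ≗τ a) (σ≗τ b) with u τ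
    ... | true  = refl
    ... | false = term-cong A σ≗τ
    u-∘-s : ∀ {σ} → Injective _≡_ _≡_ σ → u (σ ∘ s) ≡ not (u σ)
    u-∘-s {σ} σ-inj = ≡.trans (≡.cong₂ (λ x y → σ x <ᵇ σ y) (transpose-matchˡ {a = a} {b})
                                                          (transpose-matchʳ {a = a} {b}))
                              (<ᵇ-flip λ σa≡σb → <-irrefl (σ-inj σa≡σb) a<b)
    cancel : ∀ {σ} → Injective _≡_ _≡_ σ → K₁ σ + K₂ (σ ∘ s) ≈ 0#
    cancel {σ} σ-inj rewrite u-∘-s σ-inj with u σ
    ... | true  = trans (+-congˡ (term-∘-transpose A a<b Aa≗Ab σ-inj)) (-‿inverseʳ _)
    ... | false = +-identityˡ 0#

  det-select-rows : ∀ {n} (A : Matrix n) (f : Fin n → Fin n) →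
                    det (A ∘ f) ≈ (if isPermᵇ f then sgn f * det A else 0#)
  det-select-rows A f with isPermᵇ f in f-perm
  ... | true  = det-∘-rows A (isPermᵇ⇒injective f-perm)
  ... | false with isPermᵇ≡false⇒collision f-perm
  ...   | a , b , a<b , fa≡fb = det-equal-rows (A ∘ f) a<b (λ j → ≡.cong (λ k → A k j) fa≡fb)


AllInjective : ∀ {k n} → (Fin k → Fin n → Fin n) → Set
AllInjective τ = ∀ t → Injective _≡_ _≡_ (τ t)

compose-suc : ∀ {k n} (τ : Fin (suc k) → Fin n → Fin n) → compose τ ≡ τ zero ∘ compose (τ ∘ suc)
compose-suc {k} τ = ≡.cong (τ zero ∘_)
  (≡.trans (≡.cong (foldr (λ t f → τ t ∘ f) id) (≡.sym (List.map-tabulate id suc)))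
           (List.foldr-map (λ t f → τ t ∘ f) suc id (allFin k)))

compose-injective : ∀ {k n} (τ : Fin k → Fin n → Fin n) → AllInjective τ → Injective _≡_ _≡_ (compose τ)
compose-injective {zero}  τ τ-inj eq = eq
compose-injective {suc k} τ τ-inj {x} {y} eq = compose-injective (τ ∘ suc) (τ-inj ∘ suc) (τ-inj zero
  (≡.trans (≡.sym (≡.cong-app (compose-suc τ) x)) (≡.trans eq (≡.cong-app (compose-suc τ) y))))

PermTuples-injective : ∀ k n → All AllInjective (PermTuples k n)
PermTuples-injective zero    n = (λ ()) All.∷ All.[]
PermTuples-injective (suc k) n = concat⁺ (map⁺ (All.map extend (PermTuples-injective k n)))
  where
  extend : ∀ {τ} → AllInjective τ → All AllInjective (map (_◂ τ) (Perms n))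
  extend τ-inj = map⁺ (All.map (λ σ-perm → λ { zero → isPermᵇ⇒injective σ-perm ; (suc t) → τ-inj t })
                               (Perms-isPermᵇ n))

module Hyperdeterminant {c ℓ} (R : CommutativeRing c ℓ) where
  open CommutativeRing R hiding (zero)
  open Over R
  open Sign R
  open Determinant R
  open import Relation.Binary.Reasoning.Setoid setoid
  open import Algebra.Properties.CommutativeSemigroup *-commutativeSemigroup using (x∙yz≈y∙xz)

  sgn-compose : ∀ {k n} (τ : Fin k → Fin n → Fin n) → AllInjective τ →
                sgn (compose τ) ≈ Π[< k ] (λ t → sgn (τ t))
  sgn-compose {zero} {n} τ τ-inj = sgn-id {n}
  sgn-compose {suc k} τ τ-inj = begin
    sgn (compose τ)
      ≡⟨ ≡.cong sgn (compose-suc τ) ⟩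
    sgn (τ zero ∘ compose (τ ∘ suc))
      ≈⟨ sgn-∘ (τ-inj zero) (compose-injective (τ ∘ suc) (τ-inj ∘ suc)) ⟩
    sgn (τ zero) * sgn (compose (τ ∘ suc))
      ≈⟨ *-congˡ (sgn-compose (τ ∘ suc) (τ-inj ∘ suc)) ⟩
    sgn (τ zero) * Π[< k ] (λ t → sgn (τ (suc t)))
      ≡⟨ Πᴿ.big-allFin-suc (λ t → sgn (τ t)) ⟨
    Π[< suc k ] (λ t → sgn (τ t)) ∎

  Π-Σ-expand : ∀ n m (h : Fin n → Fin m → Carrier) →
               Π[< n ] (λ i → Σ[< m ] (h i)) ≈ Σ-list (allFuns n m) (λ f → Π[< n ] (λ i → h i (f i)))
  Π-Σ-expand zero    m h = sym (+-identityʳ 1#)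
  Π-Σ-expand (suc n) m h = begin
    Π[< suc n ] (λ i → Σ[< m ] (h i))
      ≡⟨ Πᴿ.big-allFin-suc (λ i → Σ[< m ] (h i)) ⟩
    Σ[< m ] (h zero) * Π[< n ] (λ i → Σ[< m ] (h (suc i)))
      ≈⟨ *-congˡ (Π-Σ-expand n m (h ∘ suc)) ⟩
    Σ[< m ] (h zero) * Σ-list (allFuns n m) rest
      ≈⟨ *-distribʳ-Σ _ (allFin m) (h zero) ⟩
    Σ[< m ] (λ j → h zero j * Σ-list (allFuns n m) rest)
      ≈⟨ Σᴿ.big-cong (allFin m) (λ j → *-distribˡ-Σ (h zero j) (allFuns n m) rest) ⟩
    Σ[< m ] (λ j → Σ-list (allFuns n m) (λ f → h zero j * rest f))
      ≈⟨ Σᴿ.big-comm (allFin m) (allFuns n m) _ ⟩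
    Σ-list (allFuns n m) (λ f → Σ[< m ] (λ j → h zero j * rest f))
      ≈⟨ Σᴿ.big-cong (allFuns n m) (λ f → Σᴿ.big-cong (allFin m) (λ j →
        reflexive (≡.sym (Πᴿ.big-allFin-suc (λ i → h i ((j ◂ f) i)))))) ⟩
    Σ-list (allFuns n m) (λ f → Σ[< m ] (λ j → whole (j ◂ f)))
      ≈⟨ Σᴿ.big-cong (allFuns n m) (λ f → reflexive (Σᴿ.big-map (_◂ f) (allFin m) whole)) ⟨
    Σ-list (allFuns n m) (λ f → Σ-list (map (_◂ f) (allFin m)) whole)
      ≈⟨ Σᴿ.big-concatMap (λ f → map (_◂ f) (allFin m)) (allFuns n m) whole ⟨
    Σ-list (allFuns (suc n) m) whole ∎
    where
    rest : (Fin n → Fin m) → Carrier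
    rest f = Π[< n ] (λ i → h (suc i) (f i))
    whole : (Fin (suc n) → Fin m) → Carrier
    whole f = Π[< suc n ] (λ i → h i (f i))

  Σ-PermTuples-Π : ∀ k n (g : Fin k → (Fin n → Fin n) → Carrier) →
    Σ-list (PermTuples k n) (λ τ → Π[< k ] (λ t → g t (τ t))) ≈ Π[< k ] (λ t → Σ-list (Perms n) (g t))
  Σ-PermTuples-Π zero    n g = +-identityʳ 1#
  Σ-PermTuples-Π (suc k) n g = begin
    Σ-list (PermTuples (suc k) n) G
      ≈⟨ Σᴿ.big-concatMap (λ τ → map (_◂ τ) (Perms n)) (PermTuples k n) G ⟩
    Σ-list (PermTuples k n) (λ τ → Σ-list (map (_◂ τ) (Perms n)) G)
      ≈⟨ Σᴿ.big-cong (PermTuples k n) (λ τ →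
        trans (reflexive (Σᴿ.big-map (_◂ τ) (Perms n) G))
        (Σᴿ.big-cong (Perms n) λ σ → reflexive (Πᴿ.big-allFin-suc (λ t → g t ((σ ◂ τ) t))))) ⟩
    Σ-list (PermTuples k n) (λ τ → Σ-list (Perms n) (λ σ → g zero σ * rest τ))
      ≈⟨ Σᴿ.big-cong (PermTuples k n) (λ τ → *-distribʳ-Σ (rest τ) (Perms n) (g zero)) ⟨
    Σ-list (PermTuples k n) (λ τ → Σ-list (Perms n) (g zero) * rest τ)
      ≈⟨ *-distribˡ-Σ _ (PermTuples k n) rest ⟨
    Σ-list (Perms n) (g zero) * Σ-list (PermTuples k n) rest
      ≈⟨ *-congˡ (Σ-PermTuples-Π k n (g ∘ suc)) ⟩
    Σ-list (Perms n) (g zero) * Π[< k ] (λ t → Σ-list (Perms n) (g (suc t)))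
      ≡⟨ Πᴿ.big-allFin-suc (λ t → Σ-list (Perms n) (g t)) ⟨
    Π[< suc k ] (λ t → Σ-list (Perms n) (g t)) ∎
    where
    G : (Fin (suc k) → Fin n → Fin n) → Carrier
    G τ = Π[< suc k ] (λ t → g t (τ t))
    rest : (Fin k → Fin n → Fin n) → Carrier
    rest τ = Π[< k ] (λ t → g (suc t) (τ t))

  productTensor : ∀ {d n} → (Fin d → Matrix n) → Tensor d n
  productTensor {d} {n} A ι = Σ[< n ] λ l → Π[< d ] λ t → A t (ι t) l

  module _ {k n : ℕ} (A : Fin (suc k) → Matrix n) where

    firstFactor : (Fin n → Fin n) → Carrier
    firstFactor f = Π[< n ] (λ i → A zero i (f i))

    hdet-summand-expand : (τ : Fin k → Fin n → Fin n) → AllInjective τ →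
      sgn (compose τ) * Π[< n ] (λ i → productTensor A (i ◂ (λ t → τ t i)))
        ≈ Σ-list (allFuns n n) (λ f → firstFactor f * Π[< k ] (λ t → term ((A (suc t) ᵀ) ∘ f) (τ t)))
    hdet-summand-expand τ τ-inj = begin
      sgn (compose τ) * Π[< n ] (λ i → productTensor A (ι i))
        ≈⟨ *-cong (sgn-compose τ τ-inj) (Π-Σ-expand n n (λ i l → Π[< suc k ] λ t → A t (ι i t) l)) ⟩
      signs * Σ-list (allFuns n n) (λ f → Π[< n ] (λ i → Π[< suc k ] λ t → A t (ι i t) (f i)))
        ≈⟨ *-distribˡ-Σ signs (allFuns n n) _ ⟩
      Σ-list (allFuns n n) (λ f → signs * Π[< n ] (λ i → Π[< suc k ] λ t → A t (ι i t) (f i)))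
        ≈⟨ Σᴿ.big-cong (allFuns n n) regroup ⟩
      Σ-list (allFuns n n) (λ f → firstFactor f * Π[< k ] (λ t → term ((A (suc t) ᵀ) ∘ f) (τ t)))  ∎
      where
      ι : Fin n → Fin (suc k) → Fin n
      ι i = i ◂ (λ t → τ t i)
      signs : Carrier
      signs = Π[< k ] (λ t → sgn (τ t))
      regroup : ∀ f → signs * Π[< n ] (λ i → Π[< suc k ] λ t → A t (ι i t) (f i))
                      ≈ firstFactor f * Π[< k ] (λ t → term ((A (suc t) ᵀ) ∘ f) (τ t))
      regroup f = begin
        signs * Π[< n ] (λ i → Π[< suc k ] λ t → A t (ι i t) (f i))
          ≈⟨ *-congˡ (Π-cong λ i → reflexive (Πᴿ.big-allFin-suc (λ t → A t (ι i t) (f i)))) ⟩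
        signs * Π[< n ] (λ i → A zero i (f i) * Π[< k ] (λ t → A (suc t) (τ t i) (f i)))
          ≈⟨ *-congˡ (Πᴿ.big-∙-distrib (allFin n) _ _) ⟩
        signs * (firstFactor f * Π[< n ] (λ i → Π[< k ] (λ t → A (suc t) (τ t i) (f i))))
          ≈⟨ *-congˡ (*-congˡ (Πᴿ.big-comm (allFin n) (allFin k) _)) ⟩
        signs * (firstFactor f * Π[< k ] (λ t → Π[< n ] (λ i → A (suc t) (τ t i) (f i))))
          ≈⟨ x∙yz≈y∙xz _ _ _ ⟩
        firstFactor f * (signs * Π[< k ] (λ t → Π[< n ] (λ i → A (suc t) (τ t i) (f i))))
          ≈⟨ *-congˡ (Πᴿ.big-∙-distrib (allFin k) _ _) ⟨
        firstFactor f * Π[< k ] (λ t → term ((A (suc t) ᵀ) ∘ f) (τ t))   ∎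

    hdet-expand : hdet (productTensor A)
                    ≈ Σ-list (allFuns n n) (λ f → firstFactor f * Π[< k ] (λ t → det ((A (suc t) ᵀ) ∘ f)))
    hdet-expand = begin
      hdet (productTensor A)
        ≈⟨ Σᴿ.big-cong-All (PermTuples-injective k n) hdet-summand-expand ⟩
      Σ-list (PermTuples k n) (λ τ → Σ-list (allFuns n n) (λ f → firstFactor f * Π[< k ] (λ t → term (B f t) (τ t))))
        ≈⟨ Σᴿ.big-comm (PermTuples k n) (allFuns n n) _ ⟩
      Σ-list (allFuns n n) (λ f → Σ-list (PermTuples k n) (λ τ → firstFactor f * Π[< k ] (λ t → term (B f t) (τ t))))
        ≈⟨ Σᴿ.big-cong (allFuns n n) (λ f → sym (*-distribˡ-Σ (firstFactor f) (PermTuples k n) _)) ⟩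
      Σ-list (allFuns n n) (λ f → firstFactor f * Σ-list (PermTuples k n) (λ τ → Π[< k ] (λ t → term (B f t) (τ t))))
        ≈⟨ Σᴿ.big-cong (allFuns n n) (λ f → *-congˡ (Σ-PermTuples-Π k n (λ t → term (B f t)))) ⟩
      Σ-list (allFuns n n) (λ f → firstFactor f * Π[< k ] (λ t → det (B f t)))   ∎
      where
      B : (Fin n → Fin n) → Fin k → Matrix n
      B f t = (A (suc t) ᵀ) ∘ f

  Π-const-odd : ∀ q (s : Carrier) → s * s ≈ 1# → Π[< suc (q ℕ.* 2) ] (λ _ → s) ≈ s
  Π-const-odd zero    s s²≈1 = *-identityʳ s
  Π-const-odd (suc q) s s²≈1 = begin
    Π[< suc (suc (suc (q ℕ.* 2))) ] (λ _ → s)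
      ≡⟨ ≡.trans (Πᴿ.big-allFin-suc {suc (suc (q ℕ.* 2))} (λ _ → s))
                 (≡.cong (s *_) (Πᴿ.big-allFin-suc {suc (q ℕ.* 2)} (λ _ → s))) ⟩
    s * (s * Π[< suc (q ℕ.* 2) ] (λ _ → s))
      ≈⟨ trans (sym (*-assoc s s _)) (*-congʳ s²≈1) ⟩
    1# * Π[< suc (q ℕ.* 2) ] (λ _ → s)
      ≈⟨ *-identityˡ _ ⟩
    Π[< suc (q ℕ.* 2) ] (λ _ → s)
      ≈⟨ Π-const-odd q s s²≈1 ⟩
    s ∎

  Π-det-select-rows : ∀ q {n} (B : Fin (suc (q ℕ.* 2)) → Matrix n) (f : Fin n → Fin n) →
    Π[< suc (q ℕ.* 2) ] (λ t → det (B t ∘ f))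
      ≈ (if isPermᵇ f then sgn f * Π[< suc (q ℕ.* 2) ] (λ t → det (B t)) else 0#)
  Π-det-select-rows q B f = trans (Π-cong λ t → det-select-rows (B t) f) (evaluate (isPermᵇ f))
    where
    evaluate : ∀ b → Π[< suc (q ℕ.* 2) ] (λ t → if b then sgn f * det (B t) else 0#)
                     ≈ (if b then sgn f * Π[< suc (q ℕ.* 2) ] (λ t → det (B t)) else 0#)
    evaluate true  = trans (Πᴿ.big-∙-distrib (allFin (suc (q ℕ.* 2))) (λ _ → sgn f) (λ t → det (B t)))
                           (*-congʳ (Π-const-odd q (sgn f) (sgn-square f)))
    evaluate false = trans (reflexive (Πᴿ.big-allFin-suc {q ℕ.* 2} (λ _ → 0#))) (zeroˡ _)

  Σ-allFuns-det : ∀ {n} (A : Matrix n) (x : Carrier) →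
    Σ-list (allFuns n n) (λ f → Π[< n ] (λ i → A i (f i)) * (if isPermᵇ f then sgn f * x else 0#)) ≈ det A * x
  Σ-allFuns-det {n} A x = begin
    Σ-list (allFuns n n) (λ f → Π[< n ] (λ i → A i (f i)) * (if isPermᵇ f then sgn f * x else 0#))
      ≈⟨ Σᴿ.big-cong (allFuns n n) (λ f → guard (isPermᵇ f)) ⟩
    Σ-list (allFuns n n) (λ f → if isPermᵇ f then term A f * x else 0#)
      ≈⟨ Σᴿ.big-filterᵇ isPermᵇ (allFuns n n) (λ σ → term A σ * x) ⟨
    Σ-list (Perms n) (λ σ → term A σ * x)
      ≈⟨ *-distribʳ-Σ x (Perms n) (term A) ⟨
    det A * x   ∎
    where
    guard : ∀ {f : Fin n → Fin n} b →
            Π[< n ] (λ i → A i (f i)) * (if b then sgn f * x else 0#) ≈ (if b then term A f * x else 0#)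
    guard true  = trans (x∙yz≈y∙xz _ _ _) (sym (*-assoc _ _ _))
    guard false = zeroʳ _


2∣suc⇒odd : ∀ {k} → 2 ∣ suc k → ∃ λ q → k ≡ suc (q ℕ.* 2)
2∣suc⇒odd (divides (suc q) 1+k≡2+2q) = q , ℕ.suc-injective 1+k≡2+2q

corollary3p7 : ∀ {c ℓ} (F : CommutativeRing c ℓ) → IsField F →
    let open CommutativeRing F
        open Over F in
    (k n : ℕ) → 2 ∣ suc k → 1 ≤ n →
    (A : Fin (suc k) → Matrix n) →
    hdet {k} {n} (λ ι → Σ[< n ] λ l → Π[< suc k ] λ t → A t (ι t) l)
      ≈ (Π[< suc k ] λ t → det (A t))
corollary3p7 F _ k n 2∣1+k _ A with 2∣suc⇒odd 2∣1+k
... | q , ≡.refl = begin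
  hdet (productTensor A)
    ≈⟨ hdet-expand A ⟩
  Σ-list (allFuns n n) (λ f → firstFactor A f * Π[< k ] (λ t → det ((A (suc t) ᵀ) ∘ f)))
    ≈⟨ Σᴿ.big-cong (allFuns n n) (λ f → *-congˡ (Π-det-select-rows q (λ t → A (suc t) ᵀ) f)) ⟩
  Σ-list (allFuns n n) (λ f → firstFactor A f * (if isPermᵇ f then sgn f * Π[< k ] (λ t → det (A (suc t) ᵀ)) else 0#))
    ≈⟨ Σ-allFuns-det (A zero) _ ⟩
  det (A zero) * Π[< k ] (λ t → det (A (suc t) ᵀ))
    ≈⟨ *-congˡ (Π-cong λ t → det-ᵀ (A (suc t))) ⟩
  det (A zero) * Π[< k ] (λ t → det (A (suc t)))
    ≡⟨ Πᴿ.big-allFin-suc (λ t → det (A t)) ⟨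
  Π[< suc k ] (λ t → det (A t))   ∎
  where
  open CommutativeRing F hiding (zero)
  open Over F
  open Hyperdeterminant F
  open Determinant F
  open import Relation.Binary.Reasoning.Setoid setoid
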